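{- Let $G=(V,E,w)$ be an undirected graph with positive edge weights, let $k\ge1$ be an integer and $\varepsilon>0$. Let $\mathcal{M}=\{M_1,\dots,M_k\}$ be the output of Algorithm STK (described in the context) on $G,k,\varepsilon$, and let $\phi(c,v)$ denote the values of its variables at termination. Then $$w(\mathcal{M})\ \ge\ \frac12\sum_{c\in[k]}\sum_{v\in V}\phi(c,v),$$ where $w(\mathcal{M})=\sum_{c\in[k]}\sum_{e\in M_c}w(e)$.
   Context: $[t]$ denotes $\{1,\dots,t\}$. Algorithm STK (input: the edges of $E$ presented one at a time in an arbitrary order, an integer $k$, and $\varepsilon>0$): Initialization: set $\phi(c,v)=0$ for all $c\in[k]$, $v\in V$; create $k$ empty stacks $S(1),\dots,S(k)$. Streaming phase: for each arriving edge $e=(u,v)$, for $c=1,2,\dots,k$ in order: let $\phi_c=\phi(c,u)+\phi(c,v)$; if $w(e)\ge(1+\varepsilon)\phi_c$, then set $w'(c,e)=w(e)-\phi_c$, increase both $\phi(c,u)$ and $\phi(c,v)$ by $w'(c,e)$, push $e$ onto $S(c)$, and stop processing $e$. If no $c$ satisfies the condition, $e$ is discarded. Post-processing: set $M_c=\emptyset$ for all $c\in[k]$. For $c=1,\dots,k$ in increasing order: while $S(c)$ is nonempty, pop the top edge $e=(u,v)$ of $S(c)$; if neither $u$ nor $v$ is an endpoint of an edge in $M_c$, add $e$ to $M_c$; otherwise, for $j=c+1,\dots,k$ in order: let $\phi_j=\phi(j,u)+\phi(j,v)$; if $w(e)\ge(1+\varepsilon)\phi_j$, set $w'(j,e)=w(e)-\phi_j$,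 increase both $\phi(j,u)$ and $\phi(j,v)$ by $w'(j,e)$, push $e$ onto $S(j)$, and stop; if no such $j$ exists, $e$ is discarded. Output: $\mathcal{M}=\{M_1,\dots,M_k\}$.
   Formalization: The edge weights and the parameter $\varepsilon$ take rational values. -}

module Defs where

open import Data.Nat using (ℕ; suc)
open import Data.Fin using (Fin; toℕ; _≟_)
open import Data.List using (List; []; _∷_; foldr; map; drop; allFin)
open import Data.Bool.ListAction using (any)
open import Data.List.Base using (foldl)
open import Data.List.Relation.Unary.All using (All)
open import Data.List.Relation.Unary.AllPairs using (AllPairs)
open import Data.Bool using (Bool; true; false; _∨_; _∧_; if_then_else_)
open import Data.Product using (_×_; _,_; proj₁; proj₂)
open import Data.Sum using (_⊎_)
open import Data.Rational using (ℚ; 0ℚ; 1ℚ; _+_; _-_; _*_; _≤_; _<_)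
open import Data.Rational.Properties using (_≤?_)
open import Relation.Nullary using (¬_; yes; no)
open import Relation.Nullary.Decidable using (⌊_⌋)
open import Relation.Binary.PropositionalEquality using (_≡_; _≢_)

record Edge (n : ℕ) : Set where
  constructor edge
  field
    u : Fin n
    v : Fin n
    w : ℚ
open Edge public

SameEnds : ∀ {n} → Edge n → Edge n → Set
SameEnds e f = (u e ≡ u f × v e ≡ v f) ⊎ (u e ≡ v f × v e ≡ u f)

-- The stream presents the edge set E of an undirected graph (no self-loops,
-- each edge exactly once) with positive weights.
ValidStream : ∀ {n} → List (Edge n) → Set
ValidStream es =
  All (λ e → u e ≢ v e) es × AllPairs (λ e f → ¬ SameEnds e f) es × All (λ e → 0ℚ < w e) es

sumℚ : List ℚ → ℚ
sumℚ = foldr _+_ 0ℚ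

-- State of STK: the values φ(c,v) and the stacks S(c) (head of list = top).
record State (k n : ℕ) : Set where
  constructor st
  field
    φ : Fin k → Fin n → ℚ
    S : Fin k → List (Edge n)
open State public

module _ {k n : ℕ} (ε : ℚ) where

  place : State k n → Edge n → Fin k → State k n
  place s e c = st φ' S'
    where
    φc = φ s c (u e) + φ s c (v e)
    w' = w e - φc
    φ' : Fin k → Fin n → ℚ
    φ' c′ x = if ⌊ c′ ≟ c ⌋ ∧ (⌊ x ≟ u e ⌋ ∨ ⌊ x ≟ v e ⌋)
              then φ s c′ x + w' else φ s c′ x
    S' : Fin k → List (Edge n)
    S' c′ = if ⌊ c′ ≟ c ⌋ then e ∷ S s c else S s c′

  tryColours : State k n → Edge n → List (Fin k) → State k n
  tryColours s e [] = s
  tryColours s e (c ∷ cs) with (1ℚ + ε) * (φ s c (u e) + φ s c (v e)) ≤? w e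
  ... | yes _ = place s e c
  ... | no  _ = tryColours s e cs

  streamPhase : List (Edge n) → State k n
  streamPhase = foldl (λ s e → tryColours s e (allFin k))
                      (st (λ _ _ → 0ℚ) (λ _ → []))

  coloursAbove : Fin k → List (Fin k)
  coloursAbove c = drop (suc (toℕ c)) (allFin k)

  touches : Edge n → List (Edge n) → Bool
  touches e M = any (λ f → ⌊ u e ≟ u f ⌋ ∨ ⌊ u e ≟ v f ⌋ ∨ ⌊ v e ≟ u f ⌋ ∨ ⌊ v e ≟ v f ⌋) M

  -- pop the edges of (the current content of) S(c) one by one, top first,
  -- building M_c; rejected edges are re-offered to colours c+1,…,k.
  -- (Pushes during this loop only go to stacks S(j), j > c.)
  popLoop : Fin k → List (Edge n) → State k n × List (Edge n) → State k n × List (Edge n)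
  popLoop c [] acc = acc
  popLoop c (e ∷ rest) (s , M) =
    if touches e M
    then popLoop c rest (tryColours s e (coloursAbove c) , M)
    else popLoop c rest (s , e ∷ M)

  emptyStack : State k n → Fin k → State k n
  emptyStack s c = st (φ s) (λ c′ → if ⌊ c′ ≟ c ⌋ then [] else S s c′)

  postPhase : State k n → State k n × (Fin k → List (Edge n))
  postPhase s₀ = foldl step (s₀ , λ _ → []) (allFin k)
    where
    step : State k n × (Fin k → List (Edge n)) → Fin k → State k n × (Fin k → List (Edge n))
    step (s , Ms) c with popLoop c (S s c) (emptyStack s c , [])
    ... | (s' , Mc) = s' , λ c′ → if ⌊ c′ ≟ c ⌋ then Mc else Ms c′

  STK : List (Edge n) → State k n × (Fin k → List (Edge n))
  STK es = postPhase (streamPhase es)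

  finalφ : List (Edge n) → Fin k → Fin n → ℚ
  finalφ es = φ (proj₁ (STK es))

  output : List (Edge n) → Fin k → List (Edge n)
  output es = proj₂ (STK es)

weightOf : ∀ {k n} → (Fin k → List (Edge n)) → ℚ
weightOf {k} Ms = sumℚ (map (λ c → sumℚ (map w (Ms c))) (allFin k))

totalφ : ∀ {k n} → (Fin k → Fin n → ℚ) → ℚ
totalφ {k} {n} f = sumℚ (map (λ c → sumℚ (map (f c) (allFin n))) (allFin k))

-- Pushing an edge e onto S(c) raises φ(c,·) at both endpoints of e by its gain w'(c,e), so
-- Σ_v φ(c,v) is always twice the total gain of the edges on S(c), and w(e) is the gain of e plus
-- φ_c, the total gain of the edges below e in S(c) that are incident to an endpoint of e. As
-- ε ≥ 0, all gains are nonnegative. Popping S(c) top-down, an accepted edge thus pays with w(e)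
-- for its own gain and for the gains of the edges below it that share an endpoint with it, while
-- a rejected edge shares an endpoint with an edge accepted before it, i.e. above it. Hence w(M_c)
-- is at least the total gain ½ Σ_v φ(c,v), and φ(c,·) does not change after S(c) is popped.

module Submission where

open import Defs
open import Data.Nat using (ℕ; suc)
open import Data.List using (List)
open import Data.Rational using (ℚ; 0ℚ; ½; _*_; _≤_; _<_)

open import Data.Bool using (T; true; false; _∨_; if_then_else_)
open import Data.Bool.Properties using (T-≡)
open import Data.Empty using (⊥-elim)
open import Data.Fin as Fin using (Fin; zero; suc; toℕ; _≟_)
open import Data.Fin.Properties using (toℕ-injective; toℕ<n)
open import Data.List using ([]; _∷_; map; drop; tabulate; allFin; foldl; foldr)
open import Data.List.Properties using (map-tabulate; drop-map; map-cong)
open import Data.List.Membership.Propositional using (_∈_; _∉_)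
open import Data.List.Membership.Propositional.Properties using (∈-map⁻)
open import Data.List.Relation.Unary.All as All using (All; []; _∷_)
open import Data.List.Relation.Unary.Any as Any using (Any; here; there)
open import Data.List.Relation.Unary.Any.Properties using (any⁻)
import Data.Nat as ℕ
import Data.Nat.Properties as ℕₚ
open import Data.Product using (∃; _×_; _,_; proj₁; proj₂)
open import Data.Sum using (_⊎_; inj₁; inj₂; [_,_])
open import Data.Unit using (⊤; tt)
open import Function using (_∘_; _$_)
open import Function.Bundles using (Equivalence)
open import Relation.Binary.PropositionalEquality
  using (_≡_; _≢_; _≗_; refl; sym; trans; cong; cong₂; subst; subst₂; module ≡-Reasoning)
open import Relation.Nullary using (Dec; yes; no)
open import Relation.Nullary.Decidable using (⌊_⌋)
open import Data.Rational using (1ℚ; _+_; _-_; -_; nonNegative)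
import Data.Rational.Properties as ℚₚ
open ℚₚ
  using (≤-refl; ≤-trans; ≤-reflexive; +-mono-≤; +-monoˡ-≤; +-monoʳ-≤; module ≤-Reasoning)
open import Data.Rational.Solver using (module +-*-Solver)
open +-*-Solver using (solve; _:+_; _:*_; _:-_; _:=_; con)

p≤q⇒0≤q-p : ∀ {p q} → p ≤ q → 0ℚ ≤ q - p
p≤q⇒0≤q-p {p} {q} p≤q = subst (_≤ q - p) (ℚₚ.+-inverseʳ p) (+-monoˡ-≤ (- p) p≤q)

p≤p+q : ∀ p {q} → 0ℚ ≤ q → p ≤ p + q
p≤p+q p {q} 0≤q = subst (_≤ p + q) (ℚₚ.+-identityʳ p) (+-monoʳ-≤ p 0≤q)

+-cancelʳ-≤ : ∀ r {p q} → p + r ≤ q + r → p ≤ q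
+-cancelʳ-≤ r {p} {q} p+r≤q+r = subst₂ _≤_ (cancel p r) (cancel q r) (+-monoˡ-≤ (- r) p+r≤q+r)
  where
  cancel : ∀ x y → x + y - y ≡ x
  cancel = solve 2 (λ x y → x :+ y :- y := x) refl

p≤[1+r]*p : ∀ {r p} → 0ℚ ≤ r → 0ℚ ≤ p → p ≤ (1ℚ + r) * p
p≤[1+r]*p {r} {p} 0≤r 0≤p = subst (p ≤_) (expand r p) (p≤p+q p 0≤rp)
  where
  0≤rp : 0ℚ ≤ r * p
  0≤rp = subst (_≤ r * p) (ℚₚ.*-zeroˡ p) (ℚₚ.*-monoʳ-≤-nonNeg p {{nonNegative 0≤p}} 0≤r)
  expand : ∀ x y → y + x * y ≡ (1ℚ + x) * y
  expand = solve 2 (λ x y → y :+ x :* y := (con 1ℚ :+ x) :* y) refl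

module _ {A : Set} where

  sum-map-cong : ∀ {f g : A → ℚ} → f ≗ g → ∀ xs → sumℚ (map f xs) ≡ sumℚ (map g xs)
  sum-map-cong f≗g xs = cong sumℚ (map-cong f≗g xs)

  sum-map-zero : ∀ {f : A → ℚ} → (∀ x → f x ≡ 0ℚ) → ∀ xs → sumℚ (map f xs) ≡ 0ℚ
  sum-map-zero f≡0 []       = refl
  sum-map-zero f≡0 (x ∷ xs) = cong₂ _+_ (f≡0 x) (sum-map-zero f≡0 xs)

  sum-map-+ : ∀ (f g : A → ℚ) xs →
    sumℚ (map (λ x → f x + g x) xs) ≡ sumℚ (map f xs) + sumℚ (map g xs)
  sum-map-+ f g []       = refl
  sum-map-+ f g (x ∷ xs) = trans (cong (f x + g x +_) (sum-map-+ f g xs)) (interchange (f x) (g x) _ _)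
    where
    interchange : ∀ a b c d → a + b + (c + d) ≡ a + c + (b + d)
    interchange = solve 4 (λ a b c d → a :+ b :+ (c :+ d) := a :+ c :+ (b :+ d)) refl

  sum-map-mono-≤ : ∀ {f g : A → ℚ} → (∀ x → f x ≤ g x) →
    ∀ xs → sumℚ (map f xs) ≤ sumℚ (map g xs)
  sum-map-mono-≤ f≤g []       = ≤-refl
  sum-map-mono-≤ f≤g (x ∷ xs) = +-mono-≤ (f≤g x) (sum-map-mono-≤ f≤g xs)

  sum-map-mono-≤-Any : ∀ {f g : A → ℚ} {δ} → (∀ x → f x ≤ g x) →
    ∀ {xs} → Any (λ x → f x + δ ≤ g x) xs → sumℚ (map f xs) + δ ≤ sumℚ (map g xs)
  sum-map-mono-≤-Any {f} {g} {δ} f≤g {x ∷ xs} (here fx+δ≤gx) = begin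
    f x + sumℚ (map f xs) + δ   ≡⟨ swap (f x) _ δ ⟩
    f x + δ + sumℚ (map f xs)   ≤⟨ +-mono-≤ fx+δ≤gx (sum-map-mono-≤ f≤g xs) ⟩
    g x + sumℚ (map g xs)       ∎
    where
    open ≤-Reasoning
    swap : ∀ a b c → a + b + c ≡ a + c + b
    swap = solve 3 (λ a b c → a :+ b :+ c := a :+ c :+ b) refl
  sum-map-mono-≤-Any {f} {g} {δ} f≤g {x ∷ xs} (there any) = begin
    f x + sumℚ (map f xs) + δ   ≡⟨ ℚₚ.+-assoc (f x) _ δ ⟩
    f x + (sumℚ (map f xs) + δ) ≤⟨ +-mono-≤ (f≤g x) (sum-map-mono-≤-Any f≤g any) ⟩
    g x + sumℚ (map g xs)       ∎
    where open ≤-Reasoning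

foldl-preserves-All : ∀ {A B : Set} (P : A → Set) {Q : B → Set} {f : A → B → A} →
  (∀ {a x} → Q x → P a → P (f a x)) → ∀ {a xs} → All Q xs → P a → P (foldl f a xs)
foldl-preserves-All P pres []         pa = pa
foldl-preserves-All P pres (qx ∷ qxs) pa = foldl-preserves-All P pres qxs (pres qx pa)

foldl-tabulate-invariant : ∀ {A B : Set} (P : ℕ → A → Set) (f : A → B → A) {m} (g : Fin m → B) →
  (∀ j a → P (toℕ j) a → P (suc (toℕ j)) (f a (g j))) →
  ∀ {a} → P 0 a → P m (foldl f a (tabulate g))
foldl-tabulate-invariant P f {ℕ.zero} g step p0 = p0
foldl-tabulate-invariant P f {suc m}  g step p0 =
  foldl-tabulate-invariant (P ∘ suc) f (g ∘ suc) (λ j → step (suc j)) (step zero _ p0)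

sumFin : ∀ {n} → (Fin n → ℚ) → ℚ
sumFin {n} f = sumℚ (map f (allFin n))

indicator : ∀ {n} → Fin n → ℚ → Fin n → ℚ
indicator a δ x = if ⌊ x ≟ a ⌋ then δ else 0ℚ

sumFin-suc : ∀ {n} (f : Fin (suc n) → ℚ) → sumFin f ≡ f zero + sumFin (f ∘ suc)
sumFin-suc f = cong (λ xs → f zero + sumℚ xs)
  (trans (map-tabulate suc f) (sym (map-tabulate (λ x → x) (f ∘ suc))))

sumFin-indicator : ∀ {n} (a : Fin n) δ → sumFin (indicator a δ) ≡ δ
sumFin-indicator {suc n} zero δ = begin
  sumFin {suc n} (indicator zero δ) ≡⟨ sumFin-suc {n} (indicator zero δ) ⟩
  δ + sumFin {n} (λ _ → 0ℚ)         ≡⟨ cong (δ +_) (sum-map-zero (λ _ → refl) (allFin n)) ⟩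
  δ + 0ℚ                            ≡⟨ ℚₚ.+-identityʳ δ ⟩
  δ                                 ∎
  where open ≡-Reasoning
sumFin-indicator {suc n} (suc a) δ = begin
  sumFin {suc n} (indicator (suc a) δ)    ≡⟨ sumFin-suc {n} (indicator (suc a) δ) ⟩
  0ℚ + sumFin (indicator (suc a) δ ∘ suc) ≡⟨ cong (0ℚ +_) (sum-map-cong indicator-suc (allFin n)) ⟩
  0ℚ + sumFin (indicator a δ)             ≡⟨ cong (0ℚ +_) (sumFin-indicator a δ) ⟩
  0ℚ + δ                                  ≡⟨ ℚₚ.+-identityˡ δ ⟩
  δ                                       ∎
  where
  open ≡-Reasoning
  indicator-suc : ∀ x → indicator (suc a) δ (suc x) ≡ indicator a δ x
  indicator-suc x with x ≟ a
  ... | yes _ = refl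
  ... | no _  = refl

Incident : ∀ {n} → Fin n → Edge n → Set
Incident x e = x ≡ u e ⊎ x ≡ v e

Adjacent : ∀ {n} → Edge n → Edge n → Set
Adjacent e f = Incident (u f) e ⊎ Incident (v f) e

endSum : ∀ {n} → (Fin n → ℚ) → Edge n → ℚ
endSum ψ e = ψ (u e) + ψ (v e)

gain : ∀ {n} → Edge n → (Fin n → ℚ) → ℚ
gain e ψ = w e - endSum ψ e

-- Pushing e onto S(c) replaces φ(c,·) by raise e (φ(c,·)); w'(c,e) is gain e (φ(c,·)).
raise : ∀ {n} → Edge n → (Fin n → ℚ) → Fin n → ℚ
raise e ψ x = if ⌊ x ≟ u e ⌋ ∨ ⌊ x ≟ v e ⌋ then ψ x + gain e ψ else ψ x

module _ {n} (e : Edge n) where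

  raise-cong : ∀ {ψ ψ′} → ψ ≗ ψ′ → raise e ψ ≗ raise e ψ′
  raise-cong {ψ} {ψ′} ψ≗ψ′ x rewrite ψ≗ψ′ x | ψ≗ψ′ (u e) | ψ≗ψ′ (v e) = refl

  raise-incident : ∀ ψ {x} → Incident x e → raise e ψ x ≡ ψ x + gain e ψ
  raise-incident ψ {x} x∈e with x ≟ u e | x ≟ v e
  ... | yes _   | _       = refl
  ... | no _    | yes _   = refl
  ... | no x≢u  | no x≢v  = ⊥-elim ([ x≢u , x≢v ] x∈e)

  ≤-raise : ∀ ψ → endSum ψ e ≤ w e → ∀ x → ψ x ≤ raise e ψ x
  ≤-raise ψ fits x with ⌊ x ≟ u e ⌋ ∨ ⌊ x ≟ v e ⌋
  ... | true  = p≤p+q (ψ x) (p≤q⇒0≤q-p fits)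
  ... | false = ≤-refl

  raise-indicator : ∀ ψ → u e ≢ v e → ∀ x →
    raise e ψ x ≡ ψ x + (indicator (u e) (gain e ψ) x + indicator (v e) (gain e ψ) x)
  raise-indicator ψ u≢v x with x ≟ u e | x ≟ v e
  ... | yes refl | yes x≡v = ⊥-elim (u≢v x≡v)
  ... | yes _    | no _    = cong (ψ x +_) (sym (ℚₚ.+-identityʳ _))
  ... | no _     | yes _   = cong (ψ x +_) (sym (ℚₚ.+-identityˡ _))
  ... | no _     | no _    = sym (ℚₚ.+-identityʳ (ψ x))

  sumFin-raise : ∀ ψ → u e ≢ v e → sumFin (raise e ψ) ≡ sumFin ψ + (gain e ψ + gain e ψ)
  sumFin-raise ψ u≢v = begin
    sumFin (raise e ψ)
      ≡⟨ sum-map-cong (raise-indicator ψ u≢v) (allFin n) ⟩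
    sumFin (λ x → ψ x + (indicator (u e) g x + indicator (v e) g x))
      ≡⟨ sum-map-+ ψ _ (allFin n) ⟩
    sumFin ψ + sumFin (λ x → indicator (u e) g x + indicator (v e) g x)
      ≡⟨ cong (sumFin ψ +_) (sum-map-+ (indicator (u e) g) (indicator (v e) g) (allFin n)) ⟩
    sumFin ψ + (sumFin (indicator (u e) g) + sumFin (indicator (v e) g))
      ≡⟨ cong (sumFin ψ +_) (cong₂ _+_ (sumFin-indicator (u e) g) (sumFin-indicator (v e) g)) ⟩
    sumFin ψ + (g + g) ∎
    where
    open ≡-Reasoning
    g = gain e ψ

  endSum-≤-raise : ∀ ψ → endSum ψ e ≤ w e → ∀ f → endSum ψ f ≤ endSum (raise e ψ) f
  endSum-≤-raise ψ fits f = +-mono-≤ (≤-raise ψ fits (u f)) (≤-raise ψ fits (v f))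

  raise-adjacent : ∀ ψ → endSum ψ e ≤ w e → ∀ {f} → Adjacent e f →
    endSum ψ f + gain e ψ ≤ endSum (raise e ψ) f
  raise-adjacent ψ fits {f} (inj₁ uf∈e) = begin
    ψ (u f) + ψ (v f) + gain e ψ    ≡⟨ swap (ψ (u f)) (ψ (v f)) (gain e ψ) ⟩
    ψ (u f) + gain e ψ + ψ (v f)    ≤⟨ +-mono-≤ (≤-reflexive (sym (raise-incident ψ uf∈e)))
                                                (≤-raise ψ fits (v f)) ⟩
    endSum (raise e ψ) f            ∎
    where
    open ≤-Reasoning
    swap : ∀ a b c → a + b + c ≡ a + c + b
    swap = solve 3 (λ a b c → a :+ b :+ c := a :+ c :+ b) refl
  raise-adjacent ψ fits {f} (inj₂ vf∈e) = begin
    ψ (u f) + ψ (v f) + gain e ψ    ≡⟨ ℚₚ.+-assoc (ψ (u f)) (ψ (v f)) (gain e ψ) ⟩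
    ψ (u f) + (ψ (v f) + gain e ψ)  ≤⟨ +-mono-≤ (≤-raise ψ fits (u f))
                                                (≤-reflexive (sym (raise-incident ψ vf∈e))) ⟩
    endSum (raise e ψ) f            ∎
    where open ≤-Reasoning

potential : ∀ {n} → List (Edge n) → Fin n → ℚ
potential = foldr raise (λ _ → 0ℚ)

Admissible : ∀ {n} → List (Edge n) → Set
Admissible []       = ⊤
Admissible (e ∷ es) = Admissible es × endSum (potential es) e ≤ w e × u e ≢ v e

admissible⇒loopless : ∀ {n} {es : List (Edge n)} → Admissible es → All (λ e → u e ≢ v e) es
admissible⇒loopless {es = []}     _               = []
admissible⇒loopless {es = e ∷ es} (adm , _ , u≢v) = u≢v ∷ admissible⇒loopless adm

potential-nonNeg : ∀ {n} (es : List (Edge n)) → Admissible es → ∀ x → 0ℚ ≤ potential es x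
potential-nonNeg []       _                x = ≤-refl
potential-nonNeg (e ∷ es) (adm , fits , _) x =
  ≤-trans (potential-nonNeg es adm x) (≤-raise e (potential es) fits x)

touches⇒Any-Adjacent : ∀ {k n} (ε : ℚ) (e : Edge n) M → touches {k} ε e M ≡ true → Any (Adjacent e) M
touches⇒Any-Adjacent ε e M touch =
  Any.map (λ {f} → adjacent {f}) (any⁻ _ M (Equivalence.from T-≡ touch))
  where
  adjacent : ∀ {f} → T (⌊ u e ≟ u f ⌋ ∨ ⌊ u e ≟ v f ⌋ ∨ ⌊ v e ≟ u f ⌋ ∨ ⌊ v e ≟ v f ⌋) →
             Adjacent e f
  adjacent {f} t with u e ≟ u f | u e ≟ v f | v e ≟ u f | v e ≟ v f
  ... | yes p | _     | _     | _     = inj₁ (inj₁ (sym p))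
  ... | no _  | yes p | _     | _     = inj₂ (inj₁ (sym p))
  ... | no _  | no _  | yes p | _     = inj₁ (inj₂ (sym p))
  ... | no _  | no _  | no _  | yes p = inj₂ (inj₂ (sym p))
  ... | no _  | no _  | no _  | no _  = ⊥-elim t

Coherent : ∀ {k n} → State k n → Fin k → Set
Coherent s c = φ s c ≗ potential (S s c) × Admissible (S s c)

coherent : ∀ {k n} (s : State k n) c {es} →
  φ s c ≗ potential es → S s c ≡ es → Admissible es → Coherent s c
coherent s c φ≗ refl adm = φ≗ , adm

module _ {k n : ℕ} (ε : ℚ) (s : State k n) (e : Edge n) (c : Fin k) where

  place-φ-self : φ (place ε s e c) c ≗ raise e (φ s c)
  place-φ-self x with c ≟ c
  ... | yes _   = refl
  ... | no c≢c  = ⊥-elim (c≢c refl)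

  place-S-self : S (place ε s e c) c ≡ e ∷ S s c
  place-S-self with c ≟ c
  ... | yes _   = refl
  ... | no c≢c  = ⊥-elim (c≢c refl)

  place-φ-other : ∀ {c′} → c′ ≢ c → φ (place ε s e c) c′ ≗ φ s c′
  place-φ-other {c′} c′≢c x with c′ ≟ c
  ... | yes c′≡c = ⊥-elim (c′≢c c′≡c)
  ... | no _     = refl

  place-S-other : ∀ {c′} → c′ ≢ c → S (place ε s e c) c′ ≡ S s c′
  place-S-other {c′} c′≢c with c′ ≟ c
  ... | yes c′≡c = ⊥-elim (c′≢c c′≡c)
  ... | no _     = refl

  place-coherent-self : 0ℚ ≤ ε → u e ≢ v e → (1ℚ + ε) * endSum (φ s c) e ≤ w e →
    Coherent s c → Coherent (place ε s e c) c
  place-coherent-self 0≤ε u≢v accepted (φ≗ , adm) =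
    coherent (place ε s e c) c (λ x → trans (place-φ-self x) (raise-cong e φ≗ x))
      place-S-self (adm , fits , u≢v)
    where
    endSum≗ : endSum (φ s c) e ≡ endSum (potential (S s c)) e
    endSum≗ = cong₂ _+_ (φ≗ (u e)) (φ≗ (v e))
    fits : endSum (potential (S s c)) e ≤ w e
    fits = ≤-trans
      (p≤[1+r]*p 0≤ε (+-mono-≤ (potential-nonNeg _ adm (u e)) (potential-nonNeg _ adm (v e))))
      (subst (λ p → (1ℚ + ε) * p ≤ w e) endSum≗ accepted)

  place-coherent-other : ∀ {c′} → c′ ≢ c → Coherent s c′ → Coherent (place ε s e c) c′
  place-coherent-other c′≢c (φ≗ , adm) =
    coherent (place ε s e c) _ (λ x → trans (place-φ-other c′≢c x) (φ≗ x)) (place-S-other c′≢c) adm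

module _ {k n : ℕ} (ε : ℚ) where

  tryColours-cases : ∀ (s : State k n) e cs → tryColours ε s e cs ≡ s ⊎
    ∃ λ c → c ∈ cs × (1ℚ + ε) * endSum (φ s c) e ≤ w e × tryColours ε s e cs ≡ place ε s e c
  tryColours-cases s e []       = inj₁ refl
  tryColours-cases s e (c ∷ cs) with (1ℚ + ε) * endSum (φ s c) e ℚₚ.≤? w e
  ... | yes accepted = inj₂ (c , here refl , accepted , refl)
  ... | no _ with tryColours-cases s e cs
  ...   | inj₁ unchanged                        = inj₁ unchanged
  ...   | inj₂ (c′ , c′∈cs , accepted , placed) = inj₂ (c′ , there c′∈cs , accepted , placed)

  tryColours-coherent : 0ℚ ≤ ε → ∀ {s : State k n} {e} cs → u e ≢ v e →
    ∀ {c} → Coherent s c → Coherent (tryColours ε s e cs) c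
  tryColours-coherent 0≤ε {s} {e} cs u≢v {c} coh with tryColours-cases s e cs
  ... | inj₁ unchanged = subst (λ s′ → Coherent s′ c) (sym unchanged) coh
  ... | inj₂ (c₀ , _ , accepted , placed) =
    subst (λ s′ → Coherent s′ c) (sym placed) (coherent-placed (c ≟ c₀))
    where
    coherent-placed : Dec (c ≡ c₀) → Coherent (place ε s e c₀) c
    coherent-placed (yes refl) = place-coherent-self ε s e c 0≤ε u≢v accepted coh
    coherent-placed (no c≢c₀)  = place-coherent-other ε s e c₀ c≢c₀ coh

  tryColours-φ-∉ : ∀ {s : State k n} {e} cs {c} → c ∉ cs → φ (tryColours ε s e cs) c ≗ φ s c
  tryColours-φ-∉ {s} {e} cs {c} c∉cs x with tryColours-cases s e cs
  ... | inj₁ unchanged = cong (λ s′ → φ s′ c x) unchanged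
  ... | inj₂ (c₀ , c₀∈cs , _ , placed) =
    trans (cong (λ s′ → φ s′ c x) placed) (place-φ-other ε s e c₀ (λ { refl → c∉cs c₀∈cs }) x)

streamPhase-coherent : ∀ {k n} {ε : ℚ} → 0ℚ ≤ ε → ∀ {es : List (Edge n)} →
  All (λ e → u e ≢ v e) es → ∀ c → Coherent (streamPhase {k} ε es) c
streamPhase-coherent {k} {ε = ε} 0≤ε loopless =
  foldl-preserves-All (λ s → ∀ c → Coherent s c)
    (λ u≢v coh c → tryColours-coherent ε 0≤ε (allFin k) u≢v (coh c))
    loopless (λ c → (λ _ → refl) , tt)

load : ∀ {n} → (Fin n → ℚ) → List (Edge n) → ℚ
load ψ M = sumℚ (map (endSum ψ) M)

weight : ∀ {n} → List (Edge n) → ℚ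
weight M = sumℚ (map w M)

-- A stands for Σ_v φ(c,v), es for the part of S(c) not yet popped and M for the part of M_c
-- built so far. Initially A = sumFin (potential es) and M = []; once es = [] it reads A ≤ 2 w(M).
PopInvariant : ∀ {n} → ℚ → List (Edge n) → List (Edge n) → Set
PopInvariant A es M =
  A + (load (potential es) M + load (potential es) M) ≤ (weight M + weight M) + sumFin (potential es)

popInvariant-start : ∀ {n} (es : List (Edge n)) → PopInvariant (sumFin (potential es)) es []
popInvariant-start es = ≤-reflexive (trans (ℚₚ.+-identityʳ Φ) (sym (ℚₚ.+-identityˡ Φ)))
  where Φ = sumFin (potential es)

module _ {n} (A : ℚ) (e : Edge n) (es M : List (Edge n)) where

  private
    ψ  = potential es
    ψ′ = raise e ψ
    g  = gain e ψ

  pop-accept : Admissible (e ∷ es) → PopInvariant A (e ∷ es) M → PopInvariant A es (e ∷ M)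
  pop-accept (_ , fits , u≢v) inv = begin
    A + ((p + load ψ M) + (p + load ψ M))
      ≤⟨ +-monoʳ-≤ A (+-mono-≤ (+-monoʳ-≤ p load≤) (+-monoʳ-≤ p load≤)) ⟩
    A + ((p + load ψ′ M) + (p + load ψ′ M))
      ≡⟨ regroup A p (load ψ′ M) ⟩
    (A + (load ψ′ M + load ψ′ M)) + (p + p)
      ≤⟨ +-monoˡ-≤ (p + p) inv ⟩
    ((weight M + weight M) + sumFin ψ′) + (p + p)
      ≡⟨ cong (λ σ → ((weight M + weight M) + σ) + (p + p)) (sumFin-raise e ψ u≢v) ⟩
    ((weight M + weight M) + (sumFin ψ + (g + g))) + (p + p)
      ≡⟨ pay (weight M) (sumFin ψ) (w e) p ⟩
    ((w e + weight M) + (w e + weight M)) + sumFin ψ ∎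
    where
    open ≤-Reasoning
    p = endSum ψ e
    load≤ : load ψ M ≤ load ψ′ M
    load≤ = sum-map-mono-≤ (endSum-≤-raise e ψ fits) M
    regroup : ∀ a p l → a + ((p + l) + (p + l)) ≡ (a + (l + l)) + (p + p)
    regroup = solve 3 (λ a p l → a :+ ((p :+ l) :+ (p :+ l)) := (a :+ (l :+ l)) :+ (p :+ p)) refl
    pay : ∀ W σ x p → ((W + W) + (σ + ((x - p) + (x - p)))) + (p + p) ≡ ((x + W) + (x + W)) + σ
    pay = solve 4 (λ W σ x p → ((W :+ W) :+ (σ :+ ((x :- p) :+ (x :- p)))) :+ (p :+ p)
                               := ((x :+ W) :+ (x :+ W)) :+ σ) refl

  pop-reject : Admissible (e ∷ es) → Any (Adjacent e) M → PopInvariant A (e ∷ es) M → PopInvariant A es M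
  pop-reject (_ , fits , u≢v) adjacent inv = +-cancelʳ-≤ (g + g) $ begin
    (A + (load ψ M + load ψ M)) + (g + g)
      ≡⟨ regroup A (load ψ M) g ⟩
    A + ((load ψ M + g) + (load ψ M + g))
      ≤⟨ +-monoʳ-≤ A (+-mono-≤ load+g≤ load+g≤) ⟩
    A + (load ψ′ M + load ψ′ M)
      ≤⟨ inv ⟩
    (weight M + weight M) + sumFin ψ′
      ≡⟨ cong ((weight M + weight M) +_) (sumFin-raise e ψ u≢v) ⟩
    (weight M + weight M) + (sumFin ψ + (g + g))
      ≡⟨ ℚₚ.+-assoc (weight M + weight M) (sumFin ψ) (g + g) ⟨
    ((weight M + weight M) + sumFin ψ) + (g + g) ∎
    where
    open ≤-Reasoning
    load+g≤ : load ψ M + g ≤ load ψ′ M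
    load+g≤ = sum-map-mono-≤-Any (endSum-≤-raise e ψ fits)
                (Any.map (λ {f} → raise-adjacent e ψ fits {f}) adjacent)
    regroup : ∀ a l g → (a + (l + l)) + (g + g) ≡ a + ((l + g) + (l + g))
    regroup = solve 3 (λ a l g → (a :+ (l :+ l)) :+ (g :+ g) := a :+ ((l :+ g) :+ (l :+ g))) refl

popInvariant-[] : ∀ {n} {A : ℚ} (M : List (Edge n)) → PopInvariant A [] M → A ≤ weight M + weight M
popInvariant-[] {n} {A} M inv = begin
  A                                 ≡⟨ ℚₚ.+-identityʳ A ⟨
  A + 0ℚ                            ≡⟨ cong (λ l → A + (l + l)) load≡0 ⟨
  A + (load 0ᶠ M + load 0ᶠ M)       ≤⟨ inv ⟩
  (weight M + weight M) + sumFin 0ᶠ ≡⟨ cong ((weight M + weight M) +_) sum≡0 ⟩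
  (weight M + weight M) + 0ℚ        ≡⟨ ℚₚ.+-identityʳ _ ⟩
  weight M + weight M               ∎
  where
  open ≤-Reasoning
  0ᶠ : Fin n → ℚ
  0ᶠ _ = 0ℚ
  load≡0 : load 0ᶠ M ≡ 0ℚ
  load≡0 = sum-map-zero (λ _ → refl) M
  sum≡0 : sumFin 0ᶠ ≡ 0ℚ
  sum≡0 = sum-map-zero (λ _ → refl) (allFin n)

module _ {k n : ℕ} (ε : ℚ) (c : Fin k) where

  private
    above : List (Fin k)
    above = coloursAbove {n = n} ε c

  popLoop-preserves : (P : State k n → Set) → ∀ {es} →
    All (λ e → ∀ {s} → P s → P (tryColours ε s e above)) es →
    ∀ s M → P s → P (proj₁ (popLoop ε c es (s , M)))
  popLoop-preserves P []                          s M ps = ps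
  popLoop-preserves P {e ∷ es} (pres ∷ press) s M ps with touches {k} ε e M
  ... | true  = popLoop-preserves P press (tryColours ε s e above) M (pres ps)
  ... | false = popLoop-preserves P press s (e ∷ M) ps

  popLoop-coherent : 0ℚ ≤ ε → ∀ {es} → Admissible es → ∀ s M {c′} →
    Coherent s c′ → Coherent (proj₁ (popLoop ε c es (s , M))) c′
  popLoop-coherent 0≤ε adm s M {c′} = popLoop-preserves (λ s′ → Coherent s′ c′)
    (All.map (λ u≢v {s′} → tryColours-coherent ε 0≤ε {s′} above u≢v) (admissible⇒loopless adm)) s M

  popLoop-φ-∉ : ∀ es s M {c′} → c′ ∉ above → φ (proj₁ (popLoop ε c es (s , M))) c′ ≗ φ s c′
  popLoop-φ-∉ es s M {c′} c′∉ = popLoop-preserves (λ s′ → φ s′ c′ ≗ φ s c′)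
    (All.universal (λ e {s′} same x → trans (tryColours-φ-∉ ε {s′} {e} above c′∉ x) (same x)) es)
    s M (λ _ → refl)

  popLoop-weight : ∀ {A : ℚ} (es : List (Edge n)) s M → Admissible es → PopInvariant A es M →
    A ≤ weight (proj₂ (popLoop ε c es (s , M))) + weight (proj₂ (popLoop ε c es (s , M)))
  popLoop-weight []           s M _   inv = popInvariant-[] M inv
  popLoop-weight {A} (e ∷ es) s M adm inv with touches {k} ε e M in touch
  ... | true  = popLoop-weight es (tryColours ε s e above) M (proj₁ adm)
                  (pop-reject A e es M adm (touches⇒Any-Adjacent {k} ε e M touch) inv)
  ... | false = popLoop-weight es s (e ∷ M) (proj₁ adm) (pop-accept A e es M adm inv)

drop-tabulate-suc : ∀ {k} i → drop i (tabulate {n = k} Fin.suc) ≡ map Fin.suc (drop i (allFin k))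
drop-tabulate-suc {k} i = trans (cong (drop i) (sym (map-tabulate (λ x → x) Fin.suc))) (drop-map i (allFin k))

∈-drop-allFin : ∀ {k} i {x : Fin k} → x ∈ drop i (allFin k) → i ℕ.≤ toℕ x
∈-drop-allFin ℕ.zero  _  = ℕ.z≤n
∈-drop-allFin {suc k} (suc i) {x} x∈ = below (∈-map⁻ Fin.suc (subst (x ∈_) (drop-tabulate-suc i) x∈))
  where
  below : ∃ (λ y → y ∈ drop i (allFin k) × x ≡ Fin.suc y) → suc i ℕ.≤ toℕ x
  below (y , y∈ , refl) = ℕ.s≤s (∈-drop-allFin i y∈)

module _ {k n : ℕ} (ε : ℚ) where

  ∈-coloursAbove⇒> : ∀ {c c′ : Fin k} → c′ ∈ coloursAbove {n = n} ε c → toℕ c ℕ.< toℕ c′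
  ∈-coloursAbove⇒> {c} = ∈-drop-allFin (suc (toℕ c))

  emptyStack-coherent : ∀ s {c c′} → c′ ≢ c → Coherent s c′ → Coherent (emptyStack {k} {n} ε s c) c′
  emptyStack-coherent s {c} {c′} c′≢c (φ≗ , adm) = coherent (emptyStack ε s c) c′ φ≗ S≡ adm
    where
    S≡ : S (emptyStack ε s c) c′ ≡ S s c′
    S≡ with c′ ≟ c
    ... | yes c′≡c = ⊥-elim (c′≢c c′≡c)
    ... | no _     = refl

  -- A copy of the loop body of postPhase, which is local to it there and cannot be referred to.
  postStep : State k n × (Fin k → List (Edge n)) → Fin k → State k n × (Fin k → List (Edge n))
  postStep (s , Ms) c = proj₁ r , λ c′ → if ⌊ c′ ≟ c ⌋ then proj₂ r else Ms c′
    where r = popLoop ε c (S s c) (emptyStack ε s c , [])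

  Settled : State k n × (Fin k → List (Edge n)) → Fin k → Set
  Settled (s , Ms) c = sumFin (φ s c) ≤ weight (Ms c) + weight (Ms c)

  PostInvariant : ℕ → State k n × (Fin k → List (Edge n)) → Set
  PostInvariant i (s , Ms) =
    (∀ c → i ℕ.≤ toℕ c → Coherent s c) × (∀ c → toℕ c ℕ.< i → Settled (s , Ms) c)

  postStep-coherent : 0ℚ ≤ ε → ∀ s Ms c → Coherent s c →
    ∀ {c′} → c′ ≢ c → Coherent s c′ → Coherent (proj₁ (postStep (s , Ms) c)) c′
  postStep-coherent 0≤ε s Ms c (_ , adm) c′≢c coh =
    popLoop-coherent ε c 0≤ε adm (emptyStack ε s c) [] (emptyStack-coherent s c′≢c coh)

  postStep-settled-self : ∀ s Ms c → Coherent s c → Settled (postStep (s , Ms) c) c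
  postStep-settled-self s Ms c (φ≗ , adm) with c ≟ c
  ... | no c≢c = ⊥-elim (c≢c refl)
  ... | yes _  = begin
    sumFin (φ (proj₁ r) c)
      ≡⟨ sum-map-cong (popLoop-φ-∉ ε c (S s c) s₀ [] c∉) (allFin n) ⟩
    sumFin (φ s c)
      ≡⟨ sum-map-cong φ≗ (allFin n) ⟩
    sumFin (potential (S s c))
      ≤⟨ popLoop-weight ε c (S s c) s₀ [] adm (popInvariant-start (S s c)) ⟩
    weight (proj₂ r) + weight (proj₂ r) ∎
    where
    open ≤-Reasoning
    s₀ = emptyStack ε s c
    r  = popLoop ε c (S s c) (s₀ , [])
    c∉ : c ∉ coloursAbove {n = n} ε c
    c∉ c∈ = ℕₚ.<-irrefl refl (∈-coloursAbove⇒> c∈)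

  postStep-settled-other : ∀ s Ms c {c′} → toℕ c′ ℕ.< toℕ c →
    Settled (s , Ms) c′ → Settled (postStep (s , Ms) c) c′
  postStep-settled-other s Ms c {c′} c′<c settled with c′ ≟ c
  ... | yes refl = ⊥-elim (ℕₚ.<-irrefl refl c′<c)
  ... | no _     = subst (_≤ weight (Ms c′) + weight (Ms c′)) (sym φ-unchanged) settled
    where
    c′∉ : c′ ∉ coloursAbove {n = n} ε c
    c′∉ c′∈ = ℕₚ.<-asym c′<c (∈-coloursAbove⇒> c′∈)
    φ-unchanged : sumFin (φ (proj₁ (postStep (s , Ms) c)) c′) ≡ sumFin (φ s c′)
    φ-unchanged = sum-map-cong (popLoop-φ-∉ ε c (S s c) (emptyStack ε s c) [] c′∉) (allFin n)

  postStep-invariant : 0ℚ ≤ ε → ∀ c acc →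
    PostInvariant (toℕ c) acc → PostInvariant (suc (toℕ c)) (postStep acc c)
  postStep-invariant 0≤ε c (s , Ms) (coherent-above , settled-below) = coherent-above′ , settled-below′
    where
    coh-c = coherent-above c ℕₚ.≤-refl
    coherent-above′ : ∀ c′ → suc (toℕ c) ℕ.≤ toℕ c′ → Coherent (proj₁ (postStep (s , Ms) c)) c′
    coherent-above′ c′ c<c′ = postStep-coherent 0≤ε s Ms c coh-c
      (λ { refl → ℕₚ.<-irrefl refl c<c′ }) (coherent-above c′ (ℕₚ.<⇒≤ c<c′))
    settled-below′ : ∀ c′ → toℕ c′ ℕ.< suc (toℕ c) → Settled (postStep (s , Ms) c) c′
    settled-below′ c′ c′≤c with ℕₚ.m<1+n⇒m<n∨m≡n c′≤c
    ... | inj₁ c′<c = postStep-settled-other s Ms c c′<c (settled-below c′ c′<c)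
    ... | inj₂ c′≡c rewrite toℕ-injective c′≡c = postStep-settled-self s Ms c coh-c

postPhase-settled : ∀ {k n} {ε : ℚ} → 0ℚ ≤ ε → ∀ {s : State k n} → (∀ c → Coherent s c) →
  ∀ c → Settled ε (postPhase ε s) c
postPhase-settled {k} {ε = ε} 0≤ε coh c = proj₂ invariant c (toℕ<n c)
  where
  invariant = foldl-tabulate-invariant (PostInvariant ε) (postStep ε) (λ c → c)
    (postStep-invariant ε 0≤ε) ((λ c _ → coh c) , λ _ ())

mainTheorem2 : (n k′ : ℕ) (ε : ℚ) (es : List (Edge n)) →
    ValidStream es → 0ℚ < ε →
    ½ * totalφ (finalφ {suc k′} ε es) ≤ weightOf (output {suc k′} ε es)
mainTheorem2 n k′ ε es (loopless , _ , _) 0<ε = begin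
  ½ * totalφ (finalφ {k} ε es)    ≤⟨ ℚₚ.*-monoˡ-≤-nonNeg ½ total ⟩
  ½ * (weightOf 𝓜 + weightOf 𝓜)  ≡⟨ half-double (weightOf 𝓜) ⟩
  weightOf 𝓜                      ∎
  where
  open ≤-Reasoning
  k = suc k′
  𝓜 : Fin k → List (Edge n)
  𝓜 = output ε es
  settled : ∀ c → Settled ε (STK {k} ε es) c
  settled = postPhase-settled (ℚₚ.<⇒≤ 0<ε) (streamPhase-coherent (ℚₚ.<⇒≤ 0<ε) loopless)
  total : totalφ (finalφ {k} ε es) ≤ weightOf 𝓜 + weightOf 𝓜
  total = subst (totalφ (finalφ {k} ε es) ≤_) (sum-map-+ (weight ∘ 𝓜) (weight ∘ 𝓜) (allFin k))
    (sum-map-mono-≤ settled (allFin k))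
  half-double : ∀ x → ½ * (x + x) ≡ x
  half-double = solve 1 (λ x → con ½ :* (x :+ x) := x) refl
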